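{- Let $(\Delta,\lambda,\iota,\zeta)$ be a ccv-graph and suppose $\Gamma=\mathrm{Cov}(\Delta,\lambda,\iota,\zeta)$ is vertex-transitive. If $\lambda(x)=3$ for some dart $x$ of $\Delta$, then $\Gamma$ is arc-transitive.
   Context: A graph is a quadruple $(V,D;\mathrm{beg},{}^{ -1})$ with $V\ne\emptyset$ a finite vertex set, $D$ a finite dart set, $\mathrm{beg}:D\to V$, and ${}^{ -1}$ an involution on $D$. A cyclic generalised voltage graph is $(\Delta,\lambda,\iota,\zeta)$ with $\Delta$ a finite connected graph, $\lambda:D(\Delta)\to\mathbb{N}$, $\iota:V(\Delta)\to\mathbb{N}$, $\zeta:D(\Delta)\to\mathbb{Z}$ such that for every dart $x$: $\lambda(x)\iota(\mathrm{beg}\,x)=\lambda(x^{ -1})\iota(\mathrm{beg}\,x^{ -1})$ and $\zeta(x^{ -1})\equiv-\zeta(x)\pmod{\lambda(x)\iota(\mathrm{beg}\,x)}$. Its cover $\mathrm{Cov}(\Delta,\lambda,\iota,\zeta)$ has vertices $(v,i)$, $0\le i<\iota(v)$, darts $(x,i)$, $0\le i<\lambda(x)\iota(\mathrm{beg}\,x)$, with $\mathrm{beg}(x,i)=(\mathrm{beg}\,x,\ i\bmod\iota(\mathrm{beg}\,x))$ and $(x,i)^{ -1}=(x^{ -1},\ i+\zeta(x)\bmod\lambda(x)\iota(\mathrm{beg}\,x))$. It is a ccv-graph if its cover is a finite, connected, simple, $3$-valent graph. -}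

module Defs where

open import Data.Nat as ℕ using (ℕ; NonZero; _*_)
open import Data.Nat.Properties using (m*n≢0)
open import Data.Nat.DivMod using (_mod_)
open import Data.Integer as ℤ using (ℤ; +_)
open import Data.Integer.DivMod using (_%ℕ_; n%ℕd<d)
open import Data.Integer.Divisibility using (_∣_)
open import Data.Fin using (Fin; toℕ; fromℕ<; cast)
open import Data.Product using (Σ; _×_; _,_; proj₁; proj₂)
open import Data.Empty using (⊥)
open import Relation.Nullary using (¬_)
open import Relation.Binary.PropositionalEquality using (_≡_; _≢_; sym)
open import Function.Bundles using (_↔_; Inverse)

record PreGraph : Set₁ where
  field
    V   : Set
    D   : Set
    beg : D → V
    inv : D → D

  end : D → V
  end x = beg (inv x)

open PreGraph public

-- The quadruple is a graph: ⁻¹ is an involution and V is nonempty.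
-- (Finiteness is built in wherever we use it: the base graph is given on
-- Fin-types and the cover's vertex/dart types are finite Σ-types over Fin.)
IsGraph : PreGraph → Set
IsGraph G = V G × (∀ x → inv G (inv G x) ≡ x)

data Walk (G : PreGraph) : V G → V G → Set where
  nil  : ∀ {u} → Walk G u u
  cons : ∀ {v} (x : D G) → Walk G (end G x) v → Walk G (beg G x) v

Connected : PreGraph → Set
Connected G = ∀ u v → Walk G u v

Simple : PreGraph → Set
Simple G =
  (∀ x → beg G x ≢ end G x) ×
  (∀ x y → beg G x ≡ beg G y → end G x ≡ end G y → x ≡ y)

Cubic : PreGraph → Set
Cubic G = ∀ v → Fin 3 ↔ Σ (D G) (λ x → beg G x ≡ v)

record Aut (G : PreGraph) : Set where
  field
    autV : V G ↔ V G
    autD : D G ↔ D G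
    beg-comm : ∀ x → beg G (Inverse.to autD x) ≡ Inverse.to autV (beg G x)
    inv-comm : ∀ x → inv G (Inverse.to autD x) ≡ Inverse.to autD (inv G x)

open Aut public

VertexTransitive : PreGraph → Set
VertexTransitive G = ∀ u v → Σ (Aut G) (λ α → Inverse.to (autV α) u ≡ v)

-- Arc-transitive: Aut acts transitively on darts (= arcs of a simple graph).
ArcTransitive : PreGraph → Set
ArcTransitive G = ∀ x y → Σ (Aut G) (λ α → Inverse.to (autD α) x ≡ y)

record FinGraph : Set where
  field
    nV : ℕ
    nD : ℕ
    fbeg : Fin nD → Fin nV
    finv : Fin nD → Fin nD
    finv-invol : ∀ x → finv (finv x) ≡ x
    nonempty : Fin nV

  pre : PreGraph
  pre = record { V = Fin nV ; D = Fin nD ; beg = fbeg ; inv = finv }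

open FinGraph public

record CGVGraph : Set where
  field
    Δ  : FinGraph
    lam : Fin (nD Δ) → ℕ
    iota : Fin (nV Δ) → ℕ
    zeta : Fin (nD Δ) → ℤ
    lam-pos  : ∀ x → NonZero (lam x)
    iota-pos : ∀ v → NonZero (iota v)

  N : Fin (nD Δ) → ℕ
  N x = lam x * iota (fbeg Δ x)

  N-pos : ∀ x → NonZero (N x)
  N-pos x = m*n≢0 (lam x) (iota (fbeg Δ x)) {{lam-pos x}} {{iota-pos (fbeg Δ x)}}

  field
    N-compat : ∀ x → N x ≡ N (finv Δ x)
    zeta-compat : ∀ x → (+ N x) ∣ (zeta (finv Δ x) ℤ.+ zeta x)

  CovV : Set
  CovV = Σ (Fin (nV Δ)) (λ v → Fin (iota v))

  CovD : Set
  CovD = Σ (Fin (nD Δ)) (λ x → Fin (N x))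

  covBeg : CovD → CovV
  covBeg (x , i) = fbeg Δ x , _mod_ (toℕ i) (iota (fbeg Δ x)) {{iota-pos (fbeg Δ x)}}

  covInv : CovD → CovD
  covInv (x , i) =
    finv Δ x ,
    cast (N-compat x)
      (fromℕ< (n%ℕd<d ((+ toℕ i) ℤ.+ zeta x) (N x) {{N-pos x}}))

  Cov : PreGraph
  Cov = record { V = CovV ; D = CovD ; beg = covBeg ; inv = covInv }

open CGVGraph public

IsCCV : CGVGraph → Set
IsCCV Γ = Connected (pre (Δ Γ)) × IsGraph (Cov Γ) × Connected (Cov Γ)
          × Simple (Cov Γ) × Cubic (Cov Γ)

-- A rotation (v , i) ↦ (v , i + k), (x , i) ↦ (x , i + k) of all fibres at once is an automorphism
-- of every cover: it commutes with adding ζ(x) and with reducing modulo ι(beg x), which divides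
-- λ(x) ι(beg x). If λ(x) = 3 and c = ι(beg x), the three spokes (x , 0), (x , c), (x , 2c) start
-- at the vertex (beg x , 0), so by cubicity they are all the darts there, and rotations by
-- multiples of c permute them transitively. Vertex-transitivity moves every dart to that vertex.

module Submission where

open import Defs
open import Data.Fin using (Fin)
open import Data.Product using (Σ)
open import Relation.Binary.PropositionalEquality using (_≡_)

open import Data.Fin using (toℕ; fromℕ<; cast; punchOut)
open import Data.Fin.Properties
  using (toℕ-injective; toℕ-fromℕ<; fromℕ<-cong; toℕ<n; toℕ-cast; any?; pigeonhole; punchOut-injective; _≟_; <⇒≢)
open import Data.Integer as ℤ using (ℤ; +_; _+_; _-_; _*_; ∣_∣; _⊖_)
open import Data.Integer.DivMod using (_%ℕ_; n%ℕd<d; a≡a%ℕn+[a/ℕn]*n)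
open import Data.Integer.Divisibility.Signed using (divides; ∣⇒∣ᵤ)
open import Data.Integer.Properties using (+-assoc; +-injective; m-n≡m⊖n; ∣i∣≡0⇒i≡0; i-j≡0⇒i≡j; ∣m⊝n∣≤m⊔n)
open import Data.Integer.Tactic.RingSolver using (solve-∀)
open import Data.Nat as ℕ using (ℕ; NonZero; zero; suc; pred)
open import Data.Nat.DivMod
  using (_%_; _mod_; %-distribˡ-+; %-congʳ; m%n%n≡m%n; m%n<n; [m+kn]%n≡m%n; m<n⇒m%n≡m; m∣n⇒o%n%m≡o%m; m*n%n≡0)
import Data.Nat.Divisibility as ℕ
open import Data.Nat.Properties as ℕ using (n<1+n)
import Data.Nat.Tactic.RingSolver as ℕ-Solver
open import Algebra.Properties.CommutativeSemigroup ℕ.+-commutativeSemigroup using (xy∙z≈xz∙y)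
open import Data.Product using (∃; _,_; proj₁; proj₂)
open import Data.Product.Function.Dependent.Propositional using (congˡ)
open import Function.Bundles using (_↔_; Inverse; Injection; mk↔ₛ′)
open import Function.Construct.Composition using (_↔-∘_)
open import Function.Construct.Symmetry using (↔-sym)
open import Function.Definitions using (Injective; StrictlySurjective)
open import Function.Properties.Inverse using (↔⇒↣)
open import Function.Related.Propositional using (bijection)
open import Relation.Binary.PropositionalEquality using (_≢_; refl; sym; trans; cong; subst; module ≡-Reasoning)
open import Relation.Nullary using (yes; no; contradiction)

[m%n+k]%n≡[m+k]%n : ∀ m k n .{{_ : NonZero n}} → (m % n ℕ.+ k) % n ≡ (m ℕ.+ k) % n
[m%n+k]%n≡[m+k]%n m k n = begin
  (m % n ℕ.+ k) % n           ≡⟨ %-distribˡ-+ (m % n) k n ⟩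
  (m % n % n ℕ.+ k % n) % n   ≡⟨ cong (λ r → (r ℕ.+ k % n) % n) (m%n%n≡m%n m n) ⟩
  (m % n ℕ.+ k % n) % n       ≡⟨ %-distribˡ-+ m k n ⟨
  (m ℕ.+ k) % n               ∎
  where open ≡-Reasoning

m∣n∧n<m⇒n≡0 : ∀ {m n} → m ℕ.∣ n → n ℕ.< m → n ≡ 0
m∣n∧n<m⇒n≡0 {n = zero}  _   _   = refl
m∣n∧n<m⇒n≡0 {n = suc _} m∣n n<m = contradiction m∣n (ℕ.>⇒∤ n<m)

%ℕ-unique : ∀ {z} d {r} t .{{_ : NonZero d}} → r ℕ.< d → z ≡ + r + t * + d → z %ℕ d ≡ r
%ℕ-unique {z} d {r} t r<d z≡r+td = +-injective (i-j≡0⇒i≡j _ _ (∣i∣≡0⇒i≡0 ∣r′⊖r∣≡0))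
  where
  r′ : ℕ
  r′ = z %ℕ d
  q : ℤ
  q = z ℤ./ℕ d
  r′-r≡[t-q]d : + r′ - + r ≡ (t - q) * + d
  r′-r≡[t-q]d = begin
    + r′ - + r                         ≡⟨ a-b≡[a+c]-[b+c] (+ r′) (+ r) (q * + d) ⟩
    (+ r′ + q * + d) - (+ r + q * + d) ≡⟨ cong (_- (+ r + q * + d)) (trans (sym (a≡a%ℕn+[a/ℕn]*n z d)) z≡r+td) ⟩
    (+ r + t * + d) - (+ r + q * + d)  ≡⟨ [b+td]-[b+qd]≡[t-q]d (+ r) t q (+ d) ⟩
    (t - q) * + d                      ∎
    where
    a-b≡[a+c]-[b+c] : ∀ a b c → a - b ≡ (a + c) - (b + c)
    a-b≡[a+c]-[b+c] = solve-∀
    [b+td]-[b+qd]≡[t-q]d : ∀ b t q d → (b + t * d) - (b + q * d) ≡ (t - q) * d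
    [b+td]-[b+qd]≡[t-q]d = solve-∀
    open ≡-Reasoning
  ∣r′⊖r∣≡0 : ∣ + r′ - + r ∣ ≡ 0
  ∣r′⊖r∣≡0 = m∣n∧n<m⇒n≡0 (∣⇒∣ᵤ (divides (t - q) r′-r≡[t-q]d)) (begin-strict
    ∣ + r′ - + r ∣ ≡⟨ cong ∣_∣ (m-n≡m⊖n r′ r) ⟩
    ∣ r′ ⊖ r ∣     ≤⟨ ∣m⊝n∣≤m⊔n r′ r ⟩
    r′ ℕ.⊔ r       <⟨ ℕ.⊔-lub (n%ℕd<d z d) r<d ⟩
    d              ∎)
    where open ℕ.≤-Reasoning

[m+z]%ℕn≡[m+z%ℕn]%n : ∀ m z n .{{_ : NonZero n}} → (+ m + z) %ℕ n ≡ (m ℕ.+ z %ℕ n) % n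
[m+z]%ℕn≡[m+z%ℕn]%n m z n = %ℕ-unique n (p + q) (m%n<n (m ℕ.+ r) n) (begin
  + m + z                                   ≡⟨ cong (_+_ (+ m)) (a≡a%ℕn+[a/ℕn]*n z n) ⟩
  + m + (+ r + q * + n)                     ≡⟨ +-assoc (+ m) (+ r) (q * + n) ⟨
  + (m ℕ.+ r) + q * + n                     ≡⟨ cong (_+ q * + n) (a≡a%ℕn+[a/ℕn]*n (+ (m ℕ.+ r)) n) ⟩
  + ((m ℕ.+ r) % n) + p * + n + q * + n     ≡⟨ [a+pc]+qc≡a+[p+q]c (+ ((m ℕ.+ r) % n)) p q (+ n) ⟩
  + ((m ℕ.+ r) % n) + (p + q) * + n         ∎)
  where
  r : ℕ
  r = z %ℕ n
  p q : ℤ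
  q = z ℤ./ℕ n
  p = + (m ℕ.+ r) ℤ./ℕ n
  [a+pc]+qc≡a+[p+q]c : ∀ a p q c → a + p * c + q * c ≡ a + (p + q) * c
  [a+pc]+qc≡a+[p+q]c = solve-∀
  open ≡-Reasoning

rotate : ∀ {n} .{{_ : NonZero n}} → ℕ → Fin n → Fin n
rotate {n} k i = (toℕ i ℕ.+ k) mod n

module _ {n} .{{_ : NonZero n}} where

  rotate-rotate : ∀ k l (i : Fin n) → rotate l (rotate k i) ≡ rotate (k ℕ.+ l) i
  rotate-rotate k l i = fromℕ<-cong _ _ (begin
    (toℕ (rotate k i) ℕ.+ l) % n        ≡⟨ cong (λ m → (m ℕ.+ l) % n) (toℕ-fromℕ< _) ⟩
    ((toℕ i ℕ.+ k) % n ℕ.+ l) % n       ≡⟨ [m%n+k]%n≡[m+k]%n (toℕ i ℕ.+ k) l n ⟩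
    (toℕ i ℕ.+ k ℕ.+ l) % n             ≡⟨ cong (_% n) (ℕ.+-assoc (toℕ i) k l) ⟩
    (toℕ i ℕ.+ (k ℕ.+ l)) % n           ∎) _ _
    where open ≡-Reasoning

  rotate-by-multiple : ∀ m (i : Fin n) → rotate (m ℕ.* n) i ≡ i
  rotate-by-multiple m i = toℕ-injective (begin
    toℕ (rotate (m ℕ.* n) i)        ≡⟨ toℕ-fromℕ< _ ⟩
    (toℕ i ℕ.+ m ℕ.* n) % n         ≡⟨ [m+kn]%n≡m%n (toℕ i) m n ⟩
    toℕ i % n                       ≡⟨ m<n⇒m%n≡m (toℕ<n i) ⟩
    toℕ i                           ∎)
    where open ≡-Reasoning

  rotation : ℕ → Fin n ↔ Fin n
  rotation k =
    mk↔ₛ′ (rotate k) (rotate k⁻) (cancel k⁻ k k⁻+k≡kn) (cancel k k⁻ (trans (ℕ.+-comm k k⁻) k⁻+k≡kn))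
    where
    k⁻ : ℕ
    k⁻ = pred n ℕ.* k
    k⁻+k≡kn : k⁻ ℕ.+ k ≡ k ℕ.* n
    k⁻+k≡kn = begin
      pred n ℕ.* k ℕ.+ k    ≡⟨ ℕ.+-comm (pred n ℕ.* k) k ⟩
      suc (pred n) ℕ.* k    ≡⟨ cong (ℕ._* k) (ℕ.suc-pred n) ⟩
      n ℕ.* k               ≡⟨ ℕ.*-comm n k ⟩
      k ℕ.* n               ∎
      where open ≡-Reasoning
    cancel : ∀ a b → a ℕ.+ b ≡ k ℕ.* n → ∀ i → rotate b (rotate a i) ≡ i
    cancel a b a+b≡kn i = begin
      rotate b (rotate a i)   ≡⟨ rotate-rotate a b i ⟩
      rotate (a ℕ.+ b) i      ≡⟨ cong (λ m → rotate m i) a+b≡kn ⟩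
      rotate (k ℕ.* n) i      ≡⟨ rotate-by-multiple k i ⟩
      i                       ∎
      where open ≡-Reasoning

mod-rotate : ∀ {n d} .{{_ : NonZero n}} .{{_ : NonZero d}} → d ℕ.∣ n → ∀ k (i : Fin n) →
  toℕ (rotate k i) mod d ≡ rotate k (toℕ i mod d)
mod-rotate {n} {d} d∣n k i = fromℕ<-cong _ _ (begin
  toℕ (rotate k i) % d          ≡⟨ cong (_% d) (toℕ-fromℕ< _) ⟩
  (toℕ i ℕ.+ k) % n % d         ≡⟨ m∣n⇒o%n%m≡o%m d n (toℕ i ℕ.+ k) d∣n ⟩
  (toℕ i ℕ.+ k) % d             ≡⟨ [m%n+k]%n≡[m+k]%n (toℕ i) k d ⟨
  (toℕ i % d ℕ.+ k) % d         ≡⟨ cong (λ m → (m ℕ.+ k) % d) (toℕ-fromℕ< _) ⟨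
  (toℕ (toℕ i mod d) ℕ.+ k) % d ∎) _ _
  where open ≡-Reasoning

translate : ∀ {n} .{{_ : NonZero n}} → ℤ → Fin n → Fin n
translate {n} z i = fromℕ< (n%ℕd<d (+ toℕ i + z) n)

translate-rotate : ∀ {n} .{{_ : NonZero n}} z k (i : Fin n) →
  translate z (rotate k i) ≡ rotate k (translate z i)
translate-rotate {n} z k i = fromℕ<-cong _ _ (begin
  (+ toℕ (rotate k i) + z) %ℕ n   ≡⟨ [m+z]%ℕn≡[m+z%ℕn]%n (toℕ (rotate k i)) z n ⟩
  (toℕ (rotate k i) ℕ.+ r) % n    ≡⟨ cong (λ m → (m ℕ.+ r) % n) (toℕ-fromℕ< _) ⟩
  ((toℕ i ℕ.+ k) % n ℕ.+ r) % n   ≡⟨ [m%n+k]%n≡[m+k]%n (toℕ i ℕ.+ k) r n ⟩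
  (toℕ i ℕ.+ k ℕ.+ r) % n         ≡⟨ cong (_% n) (xy∙z≈xz∙y (toℕ i) k r) ⟩
  (toℕ i ℕ.+ r ℕ.+ k) % n         ≡⟨ [m%n+k]%n≡[m+k]%n (toℕ i ℕ.+ r) k n ⟨
  ((toℕ i ℕ.+ r) % n ℕ.+ k) % n   ≡⟨ cong (λ m → (m ℕ.+ k) % n) toℕ-translate ⟨
  (toℕ (translate z i) ℕ.+ k) % n ∎) _ _
  where
  open ≡-Reasoning
  r : ℕ
  r = z %ℕ n
  toℕ-translate : toℕ (translate z i) ≡ (toℕ i ℕ.+ r) % n
  toℕ-translate = trans (toℕ-fromℕ< _) ([m+z]%ℕn≡[m+z%ℕn]%n (toℕ i) z n)

cast-rotate : ∀ {m n} .{{_ : NonZero m}} .{{_ : NonZero n}} (e : m ≡ n) k (i : Fin m) →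
  cast e (rotate k i) ≡ rotate k (cast e i)
cast-rotate {m} {n} e k i = toℕ-injective (begin
  toℕ (cast e (rotate k i))       ≡⟨ toℕ-cast e (rotate k i) ⟩
  toℕ (rotate k i)                ≡⟨ toℕ-fromℕ< _ ⟩
  (toℕ i ℕ.+ k) % m               ≡⟨ %-congʳ e ⟩
  (toℕ i ℕ.+ k) % n               ≡⟨ cong (λ j → (j ℕ.+ k) % n) (toℕ-cast e i) ⟨
  (toℕ (cast e i) ℕ.+ k) % n      ≡⟨ toℕ-fromℕ< _ ⟨
  toℕ (rotate k (cast e i))       ∎)
  where open ≡-Reasoning

injective⇒surjective : ∀ {n} {f : Fin n → Fin n} → Injective _≡_ _≡_ f → StrictlySurjective _≡_ f
injective⇒surjective {suc n} {f} f-inj j with any? (λ i → f i ≟ j)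
... | yes j∈im = j∈im
... | no  j∉im =
  let i , i′ , i<i′ , collision = pigeonhole (n<1+n n) (λ i → punchOut (j≢f i))
  in  contradiction (f-inj (punchOut-injective (j≢f i) (j≢f i′) collision)) (<⇒≢ i<i′)
  where
  j≢f : ∀ i → j ≢ f i
  j≢f i j≡fi = j∉im (i , sym j≡fi)

to-injective : ∀ {A B : Set} (E : A ↔ B) → Injective _≡_ _≡_ (Inverse.to E)
to-injective E = Injection.injective (↔⇒↣ E)

injective⇒onto : ∀ {A : Set} {P : A → Set} {n} → Fin n ↔ Σ A P →
  (f : Fin n → A) → Injective _≡_ _≡_ f → (∀ i → P (f i)) → ∀ {a} → P a → ∃ λ i → f i ≡ a
injective⇒onto E f f-inj f∈P a∈P =
  let i , gi≡[a] = injective⇒surjective g-inj (Inverse.from E (_ , a∈P))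
  in  i , cong proj₁ (to-injective (↔-sym E) gi≡[a])
  where
  g-inj : Injective _≡_ _≡_ (λ i → Inverse.from E (f i , f∈P i))
  g-inj gi≡gj = f-inj (cong proj₁ (to-injective (↔-sym E) gi≡gj))

_∘ᴬ_ : ∀ {G} → Aut G → Aut G → Aut G
β ∘ᴬ α = record
  { autV     = autV β ↔-∘ autV α
  ; autD     = autD β ↔-∘ autD α
  ; beg-comm = λ x → trans (beg-comm β _) (cong (Inverse.to (autV β)) (beg-comm α x))
  ; inv-comm = λ x → trans (inv-comm β _) (cong (Inverse.to (autD β)) (inv-comm α x))
  }

aut-sym : ∀ {G} → Aut G → Aut G
aut-sym {G} α = record
  { autV     = ↔-sym (autV α)
  ; autD     = ↔-sym (autD α)
  ; beg-comm = λ x → to-injective (autV α) (begin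
      to αV (beg G (from αD x))   ≡⟨ beg-comm α (from αD x) ⟨
      beg G (to αD (from αD x))   ≡⟨ cong (beg G) (strictlyInverseˡ αD x) ⟩
      beg G x                     ≡⟨ strictlyInverseˡ αV (beg G x) ⟨
      to αV (from αV (beg G x))   ∎)
  ; inv-comm = λ x → to-injective (autD α) (begin
      to αD (inv G (from αD x))   ≡⟨ inv-comm α (from αD x) ⟨
      inv G (to αD (from αD x))   ≡⟨ cong (inv G) (strictlyInverseˡ αD x) ⟩
      inv G x                     ≡⟨ strictlyInverseˡ αD (inv G x) ⟨
      to αD (from αD (inv G x))   ∎)
  }
  where
  open Inverse
  open ≡-Reasoning
  αV : V G ↔ V G
  αV = autV α
  αD : D G ↔ D G
  αD = autD α

DartsAt : (G : PreGraph) → V G → Set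
DartsAt G v = Σ (D G) (λ y → beg G y ≡ v)

DartTransitiveAt : (G : PreGraph) → V G → Set
DartTransitiveAt G o =
  ∀ {y z} → beg G y ≡ o → beg G z ≡ o → Σ (Aut G) (λ α → Inverse.to (autD α) y ≡ z)

vertexTransitive⇒arcTransitive : ∀ {G} → VertexTransitive G → (o : V G) →
  DartTransitiveAt G o → ArcTransitive G
vertexTransitive⇒arcTransitive {G} vt o dartTransitive a b =
  let α , αa≡o = vt (beg G a) o
      β , βb≡o = vt (beg G b) o
      γ , γαa≡βb = dartTransitive (trans (beg-comm α a) αa≡o) (trans (beg-comm β b) βb≡o)
  in  aut-sym β ∘ᴬ (γ ∘ᴬ α)
    , trans (cong (Inverse.from (autD β)) γαa≡βb) (Inverse.strictlyInverseʳ (autD β) b)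

module _ (Γ : CGVGraph) where

  private instance
    iota-nonZero : ∀ {v} → NonZero (iota Γ v)
    iota-nonZero = iota-pos Γ _
    N-nonZero : ∀ {x} → NonZero (N Γ x)
    N-nonZero = N-pos Γ _
    lam-nonZero : ∀ {x} → NonZero (lam Γ x)
    lam-nonZero = lam-pos Γ _

  covRotation : ℕ → Aut (Cov Γ)
  covRotation k = record
    { autV     = congˡ {A = λ v → Fin (iota Γ v)} {B = λ v → Fin (iota Γ v)} {k = bijection} (rotation k)
    ; autD     = congˡ {A = λ x → Fin (N Γ x)} {B = λ x → Fin (N Γ x)} {k = bijection} (rotation k)
    ; beg-comm = λ (x , i) → cong (fbeg (Δ Γ) x ,_) (mod-rotate (ℕ.n∣m*n (lam Γ x)) k i)
      -- covInv (x , i) is (x⁻¹ , cast (translate ζ(x) i)) by the definition of the cover.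
    ; inv-comm = λ (x , i) → cong (finv (Δ Γ) x ,_) (trans
        (cong (cast (N-compat Γ x)) (translate-rotate (zeta Γ x) k i))
        (cast-rotate (N-compat Γ x) k (translate (zeta Γ x) i)))
    }

  hub : Fin (nD (Δ Γ)) → CovV Γ
  hub x = fbeg (Δ Γ) x , 0 mod iota Γ (fbeg (Δ Γ) x)

  spoke : (x : Fin (nD (Δ Γ))) → Fin (lam Γ x) → CovD Γ
  spoke x t = x , fromℕ< (ℕ.*-monoˡ-< (iota Γ (fbeg (Δ Γ) x)) (toℕ<n t))

  module _ (x : Fin (nD (Δ Γ))) where
    private
      c l : ℕ
      c = iota Γ (fbeg (Δ Γ) x)
      l = lam Γ x

    toℕ-spoke : ∀ t → toℕ (proj₂ (spoke x t)) ≡ toℕ t ℕ.* c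
    toℕ-spoke t = toℕ-fromℕ< _

    spoke-beg : ∀ t → covBeg Γ (spoke x t) ≡ hub x
    spoke-beg t = cong (fbeg (Δ Γ) x ,_) (fromℕ<-cong _ _ (begin
      toℕ (proj₂ (spoke x t)) % c   ≡⟨ cong (_% c) (toℕ-spoke t) ⟩
      toℕ t ℕ.* c % c               ≡⟨ m*n%n≡0 (toℕ t) c ⟩
      0                             ≡⟨ m*n%n≡0 0 c ⟨
      0 % c                         ∎) _ _)
      where open ≡-Reasoning

    spoke-injective : Injective _≡_ _≡_ (spoke x)
    spoke-injective {s} {t} spoke-s≡spoke-t = toℕ-injective (ℕ.*-cancelʳ-≡ (toℕ s) (toℕ t) c (begin
      toℕ s ℕ.* c                   ≡⟨ toℕ-spoke s ⟨
      toℕ (proj₂ (spoke x s))       ≡⟨ cong (λ y → toℕ (proj₂ y)) spoke-s≡spoke-t ⟩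
      toℕ (proj₂ (spoke x t))       ≡⟨ toℕ-spoke t ⟩
      toℕ t ℕ.* c                   ∎))
      where open ≡-Reasoning

    spokeRotation : Fin l → Fin l → Aut (Cov Γ)
    spokeRotation s t = covRotation ((toℕ t ℕ.+ pred l ℕ.* toℕ s) ℕ.* c)

    spokeRotation-spoke : ∀ s t → Inverse.to (autD (spokeRotation s t)) (spoke x s) ≡ spoke x t
    spokeRotation-spoke s t = cong (x ,_) (toℕ-injective (begin
      toℕ (rotate k (proj₂ (spoke x s)))            ≡⟨ toℕ-fromℕ< _ ⟩
      (toℕ (proj₂ (spoke x s)) ℕ.+ k) % n           ≡⟨ cong (λ m → (m ℕ.+ k) % n) (toℕ-spoke s) ⟩
      (toℕ s ℕ.* c ℕ.+ k) % n                       ≡⟨ cong (_% n) [sc+k]≡tc+sn ⟩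
      (toℕ t ℕ.* c ℕ.+ toℕ s ℕ.* n) % n             ≡⟨ [m+kn]%n≡m%n (toℕ t ℕ.* c) (toℕ s) n ⟩
      toℕ t ℕ.* c % n                               ≡⟨ m<n⇒m%n≡m (ℕ.*-monoˡ-< c (toℕ<n t)) ⟩
      toℕ t ℕ.* c                                   ≡⟨ toℕ-spoke t ⟨
      toℕ (proj₂ (spoke x t))                       ∎))
      where
      open ≡-Reasoning
      k n : ℕ
      k = (toℕ t ℕ.+ pred l ℕ.* toℕ s) ℕ.* c
      n = l ℕ.* c
      ring : ∀ s t m c → s ℕ.* c ℕ.+ (t ℕ.+ m ℕ.* s) ℕ.* c ≡ t ℕ.* c ℕ.+ s ℕ.* (suc m ℕ.* c)
      ring = ℕ-Solver.solve-∀
      [sc+k]≡tc+sn : toℕ s ℕ.* c ℕ.+ k ≡ toℕ t ℕ.* c ℕ.+ toℕ s ℕ.* n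
      [sc+k]≡tc+sn = trans (ring (toℕ s) (toℕ t) (pred l) c)
        (cong (λ l → toℕ t ℕ.* c ℕ.+ toℕ s ℕ.* (l ℕ.* c)) (ℕ.suc-pred l))

    spokes-dartTransitive : Fin l ↔ DartsAt (Cov Γ) (hub x) →
      DartTransitiveAt (Cov Γ) (hub x)
    spokes-dartTransitive darts-at-hub {y} {z} y-at-hub z-at-hub =
      let s , spoke-s≡y = spoke-onto y-at-hub
          t , spoke-t≡z = spoke-onto z-at-hub
          ρ = Inverse.to (autD (spokeRotation s t))
      in  spokeRotation s t , (begin
            ρ y           ≡⟨ cong ρ spoke-s≡y ⟨
            ρ (spoke x s) ≡⟨ spokeRotation-spoke s t ⟩
            spoke x t     ≡⟨ spoke-t≡z ⟩
            z             ∎)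
      where
      open ≡-Reasoning
      spoke-onto : ∀ {y} → covBeg Γ y ≡ hub x → ∃ λ t → spoke x t ≡ y
      spoke-onto = injective⇒onto darts-at-hub (spoke x) spoke-injective spoke-beg

lemma5p5 : (Γ : CGVGraph) → IsCCV Γ → VertexTransitive (Cov Γ)
    → Σ (Fin (nD (Δ Γ))) (λ x → lam Γ x ≡ 3)
    → ArcTransitive (Cov Γ)
lemma5p5 Γ (_ , _ , _ , _ , cubic) vt (x , lam≡3) =
  vertexTransitive⇒arcTransitive vt (hub Γ x)
    (spokes-dartTransitive Γ x darts-at-hub)
  where
  darts-at-hub : Fin (lam Γ x) ↔ DartsAt (Cov Γ) (hub Γ x)
  darts-at-hub = subst (λ n → Fin n ↔ DartsAt (Cov Γ) (hub Γ x)) (sym lam≡3) (cubic (hub Γ x))
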